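{- Let $G$ and $H$ be two simple undirected graphs with $n$ vertices each. Then $G\cong H$ (graph isomorphism) if and only if $M[\beta(G,n)]\cong_s M[\beta(H,n)]$ for any coding sequences $\beta(G,n)$ and $\beta(H,n)$ of $G$ and $H$ respectively.
   Context: Coding sequences: for a simple graph $G=(V,E)$ with $n$ vertices, choose a labeling $V=\{v_0,\ldots,v_{n-1}\}$ (vertex $v_i$ is also called $10^i$). For an edge $e=v_iv_j$ with $i>j$ let $f^\#(e)=(x_1,\ldots,x_{n-1})\in\mathbb{Z}_2^{n-1}$ with $x_k=1$ iff $n-i\le k\le n-j-1$ and $x_k=0$ otherwise. The coding sequence $\beta(G,n)$ (for that labeling) is $\{f^\#(e):e\in E\}$. $C(n-1)$ denotes the set of non-zero vectors of $\mathbb{Z}_2^{n-1}$ whose $1$'s occupy consecutive coordinates (consecutive $1$'s property). For a non-empty $S\subseteq\mathbb{Z}_2^{n-1}$, $M[S]$ is the binary column matroid of the $\mathbb{Z}_2$-matrix whose columns are exactly the elements of $S$ (independent sets are the linearly independent subsets of $S$); a binary matroid $M[A]$ is identified with the set of columns of $A$. A binary matroid $M[A]$ is a simple segment binary matroid if the columns of $A$ are non-zero, pairwise distinct, and each column has the consecutive $1$'s property. Strong isomorphism: two simple segment binary matroids $M[A_1]$, $M[A_2]$ are strongly isomorphic, written $M[A_1]\cong_s M[A_2]$, if (1) $A_1,A_2$ are $(n-1)\times m$ matrices over $\mathbb{Z}_2$ for some $m,n\in\mathbb{N}$, $n\ge 2$, and (2) there exists a bijective linear operator $T$ on $\mathbb{Z}_2^{n-1}$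 such that (i) $T$ restricted to $C(n-1)$ is a bijection of $C(n-1)$ onto itself, and (ii) $T$ restricted to the set of columns of $A_1$ is a bijection onto the set of columns of $A_2$. -}

module Defs where

open import Data.Nat using (ℕ; suc; _∸_; _<ᵇ_; _≤ᵇ_)
open import Data.Bool using (Bool; true; false; _∧_; _xor_; if_then_else_)
open import Data.Fin using (Fin; toℕ) renaming (_≤_ to _≤ᶠ_)
open import Data.Vec using (Vec; tabulate; zipWith; lookup)
open import Data.Fin.Permutation using (Permutation′; _⟨$⟩ʳ_)
open import Data.Product using (Σ; ∃; ∃-syntax; _×_)
open import Function using (Bijective; _⇔_)
open import Relation.Binary.PropositionalEquality using (_≡_)

record SimpleGraph (n : ℕ) : Set where
  field
    adj    : Fin n → Fin n → Bool
    sym    : ∀ u v → adj u v ≡ adj v u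
    irrefl : ∀ u → adj u u ≡ false
open SimpleGraph public

-- Graph isomorphism: a permutation of the vertices preserving adjacency
-- (in both directions, since adj is Boolean-valued and equality is required).
_≅G_ : {n : ℕ} → SimpleGraph n → SimpleGraph n → Set
_≅G_ {n} G H = Σ (Permutation′ n) λ π →
  ∀ u v → adj G u v ≡ adj H (π ⟨$⟩ʳ u) (π ⟨$⟩ʳ v)

Z2^ : ℕ → Set
Z2^ d = Vec Bool d

_⊕_ : {d : ℕ} → Z2^ d → Z2^ d → Z2^ d
_⊕_ = zipWith _xor_

VSet : ℕ → Set₁
VSet d = Z2^ d → Set

-- f^#(v_i v_j) for i > j, as an element of Z_2^{n-1}.
-- Coordinate k ∈ {1,…,n-1} of the paper is stored at position k-1 (Fin (n ∸ 1)).
-- x_k = 1 iff n-i ≤ k ≤ n-j-1.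
fsharp : (n i j : ℕ) → Z2^ (n ∸ 1)
fsharp n i j = tabulate λ (p : Fin (n ∸ 1)) →
  (n ∸ i ≤ᵇ suc (toℕ p)) ∧ (suc (toℕ p) ≤ᵇ n ∸ j ∸ 1)

fedge : (n : ℕ) → Fin n → Fin n → Z2^ (n ∸ 1)
fedge n a b = if toℕ b <ᵇ toℕ a then fsharp n (toℕ a) (toℕ b)
                                else fsharp n (toℕ b) (toℕ a)

-- A labeling of G: σ assigns to each vertex u its label (index) σ u, i.e. u = v_{σ u}.
-- Coding sequence β(G,n) for labeling σ, as a subset of Z_2^{n-1}.
coding : {n : ℕ} → SimpleGraph n → Permutation′ n → VSet (n ∸ 1)
coding {n} G σ x = ∃[ u ] ∃[ v ] (adj G u v ≡ true × x ≡ fedge n (σ ⟨$⟩ʳ u) (σ ⟨$⟩ʳ v))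

C : (d : ℕ) → VSet d
C d x = Σ (Fin d) λ a → Σ (Fin d) λ b → a ≤ᶠ b ×
  (∀ k → (lookup x k ≡ true) ⇔ (a ≤ᶠ k × k ≤ᶠ b))

-- Linear operator on Z_2^d (additivity suffices over Z_2).
IsLinear : {d : ℕ} → (Z2^ d → Z2^ d) → Set
IsLinear T = ∀ x y → T (x ⊕ y) ≡ T x ⊕ T y

BijOnto : {d : ℕ} → (Z2^ d → Z2^ d) → VSet d → VSet d → Set
BijOnto T S S′ =
  (∀ x → S x → S′ (T x)) ×
  (∀ x y → S x → S y → T x ≡ T y → x ≡ y) ×
  (∀ y → S′ y → ∃[ x ] (S x × T x ≡ y))

-- Strong isomorphism of the simple segment binary matroids M[S₁], M[S₂]
-- (identified with their column sets S₁, S₂ ⊆ Z_2^{n-1}), with n ≥ 2.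
StronglyIso : (n : ℕ) → VSet (n ∸ 1) → VSet (n ∸ 1) → Set
StronglyIso n S₁ S₂ = (2 Data.Nat.≤ n) × Σ (Z2^ (n ∸ 1) → Z2^ (n ∸ 1)) λ T →
  IsLinear T × Bijective _≡_ _≡_ T × BijOnto T (C (n ∸ 1)) (C (n ∸ 1)) × BijOnto T S₁ S₂

module Submission where

-- The coboundary ∂x(t) = x_{t-1} + x_t (with x_{-1} = x_m = 0) identifies ℤ₂^m
-- with the even subsets of the vertex set Fin n.  Under ∂ the segment vector with ones
-- on [min(a,b), max(a,b)) becomes the pair {a, b}; the consecutive-ones vectors C(m) are
-- exactly these segments, i.e. the edges of K_n, and the code f^# of an edge is the
-- segment between the reversed labels of its endpoints.
--   (⇒) A vertex permutation ρ acts linearly on ℤ₂^m by permuting ∂-coordinates and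
--       maps segments to segments; for an isomorphism π, the action of
--       ρ = σ′⁻¹ ; π ; τ′ (σ′, τ′ the reversed labelings) is a strong isomorphism.
--   (⇐) Whitney-type rigidity: a linear injection preserving C(m) is induced by a
--       vertex permutation (the images of the edges at one vertex all share a centre),
--       and the vertex bijection it induces transfers adjacency between G and H.

open import Defs hiding (sym)
open import Algebra.Bundles using (CommutativeRing)
import Algebra.Properties.CommutativeMonoid.Sum as MonoidSum
import Algebra.Properties.CommutativeSemigroup as CommSemigroupProperties
open import Data.Bool using (Bool; true; false; _∧_; _xor_)
open import Data.Bool.Properties
  using (xor-same; xor-comm; xor-assoc; xor-identityˡ; xor-identityʳ; xor-∧-commutativeRing; T-≡; ⇔→≡; ¬-not)
open import Data.Empty using (⊥; ⊥-elim)
open import Data.Fin using (Fin; zero; suc; toℕ; fromℕ; fromℕ<; inject₁; opposite; punchOut)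
open import Data.Fin.Permutation
  using (Permutation′; _⟨$⟩ʳ_; _⟨$⟩ˡ_; inverseˡ; inverseʳ; flip; _∘ₚ_; reverse; permutation)
open import Data.Fin.Properties
  using (_≟_; any?; toℕ-injective; toℕ-fromℕ; toℕ-fromℕ<; toℕ-inject₁; toℕ<n; toℕ≤pred[n];
         opposite-prop; injective⇒≤; punchOut-injective)
open import Data.Nat using (ℕ; zero; suc; _∸_; _≤ᵇ_; _<ᵇ_; _≡ᵇ_; _≤_; _<_; z≤n; s≤s; s≤s⁻¹)
open import Data.Nat.Properties
  using (≤⇒≤ᵇ; ≤ᵇ⇒≤; ≡ᵇ⇒≡; ≡⇒≡ᵇ; <ᵇ⇒<; ≮⇒≥; <⇒≤; ≤-trans; ≤-<-trans; n≤1+n;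
         +-∸-assoc; ∸-monoʳ-≤; 1+n≰n; <-cmp)
open import Data.Product using (Σ; ∃; _×_; _,_; proj₁; proj₂)
open import Data.Sum using (_⊎_; inj₁; inj₂)
open import Data.Vec using ([]; _∷_; tabulate; lookup; replicate)
open import Data.Vec.Properties
  using (lookup-zipWith; zipWith-comm; zipWith-assoc; zipWith-identityˡ; zipWith-identityʳ;
         lookup∘tabulate; tabulate∘lookup; tabulate-cong; lookup-replicate)
open import Function using (_⇔_; mk⇔; Equivalence; Bijective)
open import Relation.Binary using (tri<; tri≈; tri>)
open import Relation.Binary.PropositionalEquality
open import Relation.Nullary using (Dec; yes; no; ¬?; _×-dec_)

private
  module Parity = MonoidSum (CommutativeRing.+-commutativeMonoid xor-∧-commutativeRing)
  module XorSemigroup =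
    CommSemigroupProperties (CommutativeRing.+-commutativeSemigroup xor-∧-commutativeRing)

xor-interchange : ∀ a b c d → (a xor b) xor (c xor d) ≡ (a xor c) xor (b xor d)
xor-interchange = XorSemigroup.interchange

xor-cancelˡ : ∀ a b → a xor (a xor b) ≡ b
xor-cancelˡ a b = trans (sym (xor-assoc a a b)) (cong (_xor b) (xor-same a))

xor≡false⇒≡ : ∀ {a b} → a xor b ≡ false → a ≡ b
xor≡false⇒≡ {false} {false} _ = refl
xor≡false⇒≡ {true}  {true}  _ = refl

xor≡true : ∀ {a b} → a xor b ≡ true → a ≡ true ⊎ b ≡ true
xor≡true {true}  {false} _ = inj₁ refl
xor≡true {false} {true}  _ = inj₂ refl

only-first : ∀ {p q r s} → p ≡ true → q ≡ false → r ≡ false → s ≡ false → (p xor q) xor (r xor s) ≡ true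
only-first refl refl refl refl = refl

only-second : ∀ {p q r s} → p ≡ false → q ≡ true → r ≡ false → s ≡ false → (p xor q) xor (r xor s) ≡ true
only-second refl refl refl refl = refl

only-third : ∀ {p q r s} → p ≡ false → q ≡ false → r ≡ true → s ≡ false → (p xor q) xor (r xor s) ≡ true
only-third refl refl refl refl = refl

true≢false : true ≢ false
true≢false ()

𝟎 : ∀ {d} → Z2^ d
𝟎 {d} = replicate d false

lookup-⊕ : ∀ {d} (x y : Z2^ d) k → lookup (x ⊕ y) k ≡ lookup x k xor lookup y k
lookup-⊕ x y k = lookup-zipWith _xor_ k x y

lookup-extensional : ∀ {d} (x y : Z2^ d) → (∀ k → lookup x k ≡ lookup y k) → x ≡ y
lookup-extensional x y h = trans (sym (tabulate∘lookup x)) (trans (tabulate-cong h) (tabulate∘lookup y))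

⊕-comm : ∀ {d} (x y : Z2^ d) → x ⊕ y ≡ y ⊕ x
⊕-comm = zipWith-comm xor-comm

⊕-assoc : ∀ {d} (x y z : Z2^ d) → (x ⊕ y) ⊕ z ≡ x ⊕ (y ⊕ z)
⊕-assoc = zipWith-assoc xor-assoc

⊕-identityˡ : ∀ {d} (x : Z2^ d) → 𝟎 ⊕ x ≡ x
⊕-identityˡ = zipWith-identityˡ xor-identityˡ

⊕-identityʳ : ∀ {d} (x : Z2^ d) → x ⊕ 𝟎 ≡ x
⊕-identityʳ = zipWith-identityʳ xor-identityʳ

⊕-self : ∀ {d} (x : Z2^ d) → x ⊕ x ≡ 𝟎
⊕-self []      = refl
⊕-self (a ∷ x) = cong₂ _∷_ (xor-same a) (⊕-self x)

⊕≡𝟎⇒≡ : ∀ {d} {x y : Z2^ d} → x ⊕ y ≡ 𝟎 → x ≡ y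
⊕≡𝟎⇒≡ {x = x} {y} h = begin
  x             ≡⟨ sym (⊕-identityʳ x) ⟩
  x ⊕ 𝟎         ≡⟨ cong (x ⊕_) (sym (⊕-self y)) ⟩
  x ⊕ (y ⊕ y)   ≡⟨ sym (⊕-assoc x y y) ⟩
  (x ⊕ y) ⊕ y   ≡⟨ cong (_⊕ y) h ⟩
  𝟎 ⊕ y         ≡⟨ ⊕-identityˡ y ⟩
  y             ∎
  where open ≡-Reasoning

linear-𝟎 : ∀ {d} (T : Z2^ d → Z2^ d) → IsLinear T → T 𝟎 ≡ 𝟎
linear-𝟎 T T-⊕ = trans (cong T (sym (⊕-self 𝟎))) (trans (T-⊕ 𝟎 𝟎) (⊕-self (T 𝟎)))

bijOnto-viaInverse : ∀ {d} (f g : Z2^ d → Z2^ d) {S S′ : VSet d} →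
                     (∀ x → g (f x) ≡ x) → (∀ y → f (g y) ≡ y) →
                     (∀ x → S x → S′ (f x)) → (∀ y → S′ y → S (g y)) → BijOnto f S S′
bijOnto-viaInverse f g g∘f f∘g into back =
  into , (λ x y _ _ e → trans (sym (g∘f x)) (trans (cong g e) (g∘f y))) , λ y s′ → g y , back y s′ , f∘g y

-- For x ∈ ℤ₂^j, 'differences b x' lists the
-- successive differences of the sequence b, x₀, …, x_{j-1}, 0; it is linear,
-- has even parity, and 'prefixSums b' inverts it on all vectors of the right parity.

differences : ∀ {j} → Bool → Z2^ j → Z2^ (suc j)
differences b []       = b ∷ []
differences b (x ∷ xs) = (b xor x) ∷ differences x xs

prefixSums : ∀ {j} → Bool → (Fin (suc j) → Bool) → Z2^ j
prefixSums {zero}  b d = []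
prefixSums {suc j} b d = (b xor d zero) ∷ prefixSums (b xor d zero) (λ t → d (suc t))

parity : ∀ {j} → (Fin j → Bool) → Bool
parity = Parity.sum

parity-permute : ∀ {j} (f : Fin j → Bool) (π : Permutation′ j) → parity f ≡ parity (λ k → f (π ⟨$⟩ʳ k))
parity-permute = Parity.sum-permute

differences-⊕ : ∀ {j} a b (x y : Z2^ j) → differences (a xor b) (x ⊕ y) ≡ differences a x ⊕ differences b y
differences-⊕ a b []       []       = refl
differences-⊕ a b (x ∷ xs) (y ∷ ys) = cong₂ _∷_ (xor-interchange a b x y) (differences-⊕ x y xs ys)

differences-𝟎 : ∀ {j} → differences false (𝟎 {j}) ≡ 𝟎
differences-𝟎 {zero}  = refl
differences-𝟎 {suc j} = cong (false ∷_) differences-𝟎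

parity-differences : ∀ {j} b (x : Z2^ j) → b xor parity (lookup (differences b x)) ≡ false
parity-differences b []       = xor-cancelˡ b false
parity-differences b (x ∷ xs) = begin
  b xor ((b xor x) xor P)   ≡⟨ sym (xor-assoc b (b xor x) P) ⟩
  (b xor (b xor x)) xor P   ≡⟨ cong (_xor P) (xor-cancelˡ b x) ⟩
  x xor P                   ≡⟨ parity-differences x xs ⟩
  false                     ∎
  where
  open ≡-Reasoning
  P : Bool
  P = parity (lookup (differences x xs))

prefixSums-cong : ∀ {j} b {d e : Fin (suc j) → Bool} → (∀ t → d t ≡ e t) → prefixSums b d ≡ prefixSums b e
prefixSums-cong {zero}  b h = refl
prefixSums-cong {suc j} b {d} {e} h rewrite h zero =
  cong ((b xor e zero) ∷_) (prefixSums-cong (b xor e zero) (λ t → h (suc t)))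

prefixSums-differences : ∀ {j} b (x : Z2^ j) → prefixSums b (lookup (differences b x)) ≡ x
prefixSums-differences b []       = refl
prefixSums-differences b (x ∷ xs) rewrite xor-cancelˡ b x = cong (x ∷_) (prefixSums-differences x xs)

differences-prefixSums : ∀ {j} b (d : Fin (suc j) → Bool) → b xor parity d ≡ false →
                         ∀ t → lookup (differences b (prefixSums b d)) t ≡ d t
differences-prefixSums {zero}  b d even zero    = trans (xor≡false⇒≡ even) (xor-identityʳ (d zero))
differences-prefixSums {suc j} b d even zero    = xor-cancelˡ b (d zero)
differences-prefixSums {suc j} b d even (suc t) =
  differences-prefixSums (b xor d zero) (λ t → d (suc t)) (trans (xor-assoc b (d zero) _) even) t

step : ∀ j → ℕ → Z2^ j
step j s = tabulate λ k → s ≤ᵇ toℕ k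

≤ᵇ-suc : ∀ a b → (suc a ≤ᵇ suc b) ≡ (a ≤ᵇ b)
≤ᵇ-suc zero    b = refl
≤ᵇ-suc (suc a) b = refl

differences-ones : ∀ j (t : Fin (suc j)) → lookup (differences true (step j 0)) t ≡ (toℕ t ≡ᵇ j)
differences-ones zero    zero    = refl
differences-ones (suc j) zero    = refl
differences-ones (suc j) (suc t) = differences-ones j t

differences-step : ∀ j s (t : Fin (suc j)) → s ≤ j →
                   lookup (differences false (step j s)) t ≡ (toℕ t ≡ᵇ s) xor (toℕ t ≡ᵇ j)
differences-step zero    zero    zero    z≤n     = refl
differences-step (suc j) zero    zero    z≤n     = refl
differences-step (suc j) zero    (suc t) z≤n     = differences-ones j t
differences-step (suc j) (suc s) zero    (s≤s _) = refl
differences-step (suc j) (suc s) (suc t) (s≤s h) =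
  trans (cong (λ v → lookup (differences false v) t) (tabulate-cong λ k → ≤ᵇ-suc s (toℕ k)))
        (differences-step j s t h)

interval-as-xor : ∀ A B k → A ≤ B → ((A ≤ᵇ k) ∧ (suc k ≤ᵇ B)) ≡ (A ≤ᵇ k) xor (B ≤ᵇ k)
interval-as-xor zero    zero    k       z≤n     = refl
interval-as-xor zero    (suc B) zero    z≤n     = refl
interval-as-xor zero    (suc B) (suc k) z≤n
  rewrite ≤ᵇ-suc (suc k) B | ≤ᵇ-suc B k = interval-as-xor zero B k z≤n
interval-as-xor (suc A) (suc B) zero    (s≤s h) = refl
interval-as-xor (suc A) (suc B) (suc k) (s≤s h)
  rewrite ≤ᵇ-suc (suc k) B | ≤ᵇ-suc B k | ≤ᵇ-suc A k = interval-as-xor A B k h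

≤ᵇ≡true⇒≤ : ∀ {a b} → (a ≤ᵇ b) ≡ true → a ≤ b
≤ᵇ≡true⇒≤ {a} {b} e = ≤ᵇ⇒≤ a b (Equivalence.from T-≡ e)

≤⇒≤ᵇ≡true : ∀ {a b} → a ≤ b → (a ≤ᵇ b) ≡ true
≤⇒≤ᵇ≡true h = Equivalence.to T-≡ (≤⇒≤ᵇ h)

∧≡true⇔ : ∀ {u v} → (u ∧ v ≡ true) ⇔ (u ≡ true × v ≡ true)
∧≡true⇔ {true}  {v} = mk⇔ (λ e → refl , e) proj₂
∧≡true⇔ {false} {v} = mk⇔ (λ ()) (λ ())

within : ℕ → ℕ → ℕ → Bool
within a b k = (a ≤ᵇ k) ∧ (k ≤ᵇ b)

within≡true⇔ : ∀ a b k → (within a b k ≡ true) ⇔ (a ≤ k × k ≤ b)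
within≡true⇔ a b k = mk⇔
  (λ e → let (p , q) = Equivalence.to ∧≡true⇔ e in ≤ᵇ≡true⇒≤ p , ≤ᵇ≡true⇒≤ q)
  (λ { (p , q) → Equivalence.from ∧≡true⇔ (≤⇒≤ᵇ≡true p , ≤⇒≤ᵇ≡true q) })

-- An injective endomap of Fin n is onto (otherwise it would inject Fin n into Fin (n - 1)).
injective⇒surjective : ∀ {n} (f : Fin n → Fin n) → (∀ {a b} → f a ≡ f b → a ≡ b) →
                       ∀ y → Σ (Fin n) λ x → f x ≡ y
injective⇒surjective {suc n} f f-inj y with any? (λ x → f x ≟ y)
... | yes hit = hit
... | no miss = ⊥-elim (1+n≰n (injective⇒≤ {f = avoid} avoid-inj))
  where
  avoid : Fin (suc n) → Fin n
  avoid x = punchOut {i = y} {j = f x} (λ e → miss (x , sym e))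
  avoid-inj : ∀ {a b} → avoid a ≡ avoid b → a ≡ b
  avoid-inj {a} {b} e = f-inj (punchOut-injective (λ e → miss (a , sym e)) (λ e → miss (b , sym e)) e)

injective⇒permutation : ∀ {n} (f : Fin n → Fin n) → (∀ {a b} → f a ≡ f b → a ≡ b) →
                        Σ (Permutation′ n) λ π → ∀ i → π ⟨$⟩ʳ i ≡ f i
injective⇒permutation {n} f f-inj = permutation f g f∘g g∘f , λ i → refl
  where
  g : Fin n → Fin n
  g y = proj₁ (injective⇒surjective f f-inj y)
  f∘g : ∀ y → f (g y) ≡ y
  f∘g y = proj₂ (injective⇒surjective f f-inj y)
  g∘f : ∀ x → g (f x) ≡ x
  g∘f x = f-inj (f∘g (f x))

permutation-injective : ∀ {n} (π : Permutation′ n) {a b} → π ⟨$⟩ʳ a ≡ π ⟨$⟩ʳ b → a ≡ b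
permutation-injective π e = trans (sym (inverseˡ π)) (trans (cong (π ⟨$⟩ˡ_) e) (inverseˡ π))

distinct-in-pair : ∀ {A : Set} {a b c d : A} → a ≢ b → a ≡ c ⊎ a ≡ d → b ≡ c ⊎ b ≡ d →
                   (a ≡ c × b ≡ d) ⊎ (a ≡ d × b ≡ c)
distinct-in-pair a≢b (inj₁ a=c) (inj₁ b=c) = ⊥-elim (a≢b (trans a=c (sym b=c)))
distinct-in-pair a≢b (inj₁ a=c) (inj₂ b=d) = inj₁ (a=c , b=d)
distinct-in-pair a≢b (inj₂ a=d) (inj₁ b=c) = inj₂ (a=d , b=c)
distinct-in-pair a≢b (inj₂ a=d) (inj₂ b=d) = ⊥-elim (a≢b (trans a=d (sym b=d)))

no-three-in-pair : ∀ {A : Set} {x y w e f : A} → x ≢ y → x ≢ w → y ≢ w →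
                     x ≡ e ⊎ x ≡ f → y ≡ e ⊎ y ≡ f → w ≡ e ⊎ w ≡ f → ⊥
no-three-in-pair x≢y _   _   (inj₁ p) (inj₁ q) _        = x≢y (trans p (sym q))
no-three-in-pair x≢y _   _   (inj₂ p) (inj₂ q) _        = x≢y (trans p (sym q))
no-three-in-pair _   x≢w _   (inj₁ p) (inj₂ q) (inj₁ r) = x≢w (trans p (sym r))
no-three-in-pair _   _   y≢w (inj₁ p) (inj₂ q) (inj₂ r) = y≢w (trans q (sym r))
no-three-in-pair _   _   y≢w (inj₂ p) (inj₁ q) (inj₁ r) = y≢w (trans q (sym r))
no-three-in-pair _   x≢w _   (inj₂ p) (inj₁ q) (inj₂ r) = x≢w (trans p (sym r))

-- The vector 'segment a b' ∈ ℤ₂^m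
-- has ones exactly at the coordinates k with min(a,b) ≤ k < max(a,b); it plays the
-- role of the edge ab of the complete graph K_{m+1}.

module Segments (m : ℕ) where

  Vertex : Set
  Vertex = Fin (suc m)

  last : Vertex
  last = fromℕ m

  threshold : Vertex → Z2^ m
  threshold b = step m (toℕ b)

  segment : Vertex → Vertex → Z2^ m
  segment a b = threshold a ⊕ threshold b

  lookup-segment : ∀ a b k → lookup (segment a b) k ≡ (toℕ a ≤ᵇ toℕ k) xor (toℕ b ≤ᵇ toℕ k)
  lookup-segment a b k =
    trans (lookup-⊕ (threshold a) (threshold b) k) (cong₂ _xor_ (lookup∘tabulate _ k) (lookup∘tabulate _ k))

  segment-comm : ∀ a b → segment a b ≡ segment b a
  segment-comm a b = ⊕-comm (threshold a) (threshold b)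

  fsharp-as-xor : ∀ i j → j ≤ i → i ≤ m →
                  fsharp (suc m) i j ≡ tabulate λ k → (m ∸ i ≤ᵇ toℕ k) xor (m ∸ j ≤ᵇ toℕ k)
  fsharp-as-xor i j j≤i i≤m = tabulate-cong λ k → begin
    (suc m ∸ i ≤ᵇ suc (toℕ k)) ∧ (suc (toℕ k) ≤ᵇ suc m ∸ j ∸ 1)
      ≡⟨ cong₂ (λ u v → (u ≤ᵇ suc (toℕ k)) ∧ (suc (toℕ k) ≤ᵇ v ∸ 1))
               (+-∸-assoc 1 i≤m) (+-∸-assoc 1 (≤-trans j≤i i≤m)) ⟩
    (suc (m ∸ i) ≤ᵇ suc (toℕ k)) ∧ (suc (toℕ k) ≤ᵇ m ∸ j)
      ≡⟨ cong (_∧ (suc (toℕ k) ≤ᵇ m ∸ j)) (≤ᵇ-suc (m ∸ i) (toℕ k)) ⟩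
    (m ∸ i ≤ᵇ toℕ k) ∧ (suc (toℕ k) ≤ᵇ m ∸ j)
      ≡⟨ interval-as-xor (m ∸ i) (m ∸ j) (toℕ k) (∸-monoʳ-≤ m j≤i) ⟩
    (m ∸ i ≤ᵇ toℕ k) xor (m ∸ j ≤ᵇ toℕ k) ∎
    where open ≡-Reasoning

  fsharp-segment : ∀ (a b : Vertex) → toℕ b ≤ toℕ a →
                   fsharp (suc m) (toℕ a) (toℕ b) ≡ segment (opposite a) (opposite b)
  fsharp-segment a b b≤a = trans (fsharp-as-xor (toℕ a) (toℕ b) b≤a (toℕ≤pred[n] a))
    (lookup-extensional _ _ λ k → trans (lookup∘tabulate _ k) (sym (trans (lookup-segment (opposite a) (opposite b) k)
      (cong₂ (λ u v → (u ≤ᵇ toℕ k) xor (v ≤ᵇ toℕ k)) (opposite-prop a) (opposite-prop b)))))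

  fedge-segment : ∀ (a b : Vertex) → fedge (suc m) a b ≡ segment (opposite a) (opposite b)
  fedge-segment a b with toℕ b <ᵇ toℕ a in b<ᵇa
  ... | true  = fsharp-segment a b (<⇒≤ (<ᵇ⇒< (toℕ b) (toℕ a) (Equivalence.from T-≡ b<ᵇa)))
  ... | false = trans (fsharp-segment b a (≮⇒≥ λ b<a → true≢false (trans (sym (≤⇒≤ᵇ≡true b<a)) b<ᵇa)))
                      (segment-comm (opposite b) (opposite a))

  IsSegment : Z2^ m → Set
  IsSegment x = Σ Vertex λ a → Σ Vertex λ b → a ≢ b × x ≡ segment a b

  lookup-segment-interval : ∀ (a : Vertex) (b′ : Fin m) k → toℕ a ≤ suc (toℕ b′) →
                            lookup (segment a (suc b′)) k ≡ within (toℕ a) (toℕ b′) (toℕ k)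
  lookup-segment-interval a b′ k a≤b = trans (lookup-segment a (suc b′) k)
    (trans (sym (interval-as-xor (toℕ a) (suc (toℕ b′)) (toℕ k) a≤b))
           (cong ((toℕ a ≤ᵇ toℕ k) ∧_) (≤ᵇ-suc (toℕ k) (toℕ b′))))

  C⇒IsSegment : ∀ x → C m x → IsSegment x
  C⇒IsSegment x (a , b , a≤b , member) = inject₁ a , suc b , a≢b+1 , lookup-extensional _ _ λ k →
      trans (lookup-as-within k) (sym (trans (lookup-segment-interval (inject₁ a) b k a≤b+1)
                                             (cong (λ u → within u (toℕ b) (toℕ k)) (toℕ-inject₁ a))))
    where
    lookup-as-within : ∀ k → lookup x k ≡ within (toℕ a) (toℕ b) (toℕ k)
    lookup-as-within k = ⇔→≡ (mk⇔
      (λ e → Equivalence.from (within≡true⇔ _ _ _) (Equivalence.to (member k) e))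
      (λ e → Equivalence.from (member k) (Equivalence.to (within≡true⇔ _ _ _) e)))
    a≤b+1 : toℕ (inject₁ a) ≤ suc (toℕ b)
    a≤b+1 = subst (_≤ suc (toℕ b)) (sym (toℕ-inject₁ a)) (≤-trans a≤b (n≤1+n _))
    a≢b+1 : inject₁ a ≢ suc b
    a≢b+1 e = 1+n≰n (subst (_≤ toℕ b) (trans (sym (toℕ-inject₁ a)) (cong toℕ e)) a≤b)

  segment∈C-ordered : ∀ (a b : Vertex) → toℕ a < toℕ b → C m (segment a b)
  segment∈C-ordered a (suc b′) a<b = a′ , b′ , a′≤b′ , λ k → mk⇔
      (λ e → Equivalence.to (within≡true⇔ _ _ _) (trans (sym (lookup-as-within k)) e))
      (λ r → trans (lookup-as-within k) (Equivalence.from (within≡true⇔ _ _ _) r))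
    where
    a≤b′ : toℕ a ≤ toℕ b′
    a≤b′ = s≤s⁻¹ a<b
    a′ : Fin m
    a′ = fromℕ< (≤-<-trans a≤b′ (toℕ<n b′))
    a′≡a : toℕ a′ ≡ toℕ a
    a′≡a = toℕ-fromℕ< (≤-<-trans a≤b′ (toℕ<n b′))
    a′≤b′ : toℕ a′ ≤ toℕ b′
    a′≤b′ = subst (_≤ toℕ b′) (sym a′≡a) a≤b′
    lookup-as-within : ∀ k → lookup (segment a (suc b′)) k ≡ within (toℕ a′) (toℕ b′) (toℕ k)
    lookup-as-within k = trans (lookup-segment-interval a b′ k (<⇒≤ a<b))
                               (cong (λ u → within u (toℕ b′) (toℕ k)) (sym a′≡a))

  segment∈C : ∀ {a b : Vertex} → a ≢ b → C m (segment a b)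
  segment∈C {a} {b} a≢b with <-cmp (toℕ a) (toℕ b)
  ... | tri< a<b _ _ = segment∈C-ordered a b a<b
  ... | tri≈ _ a=b _ = ⊥-elim (a≢b (toℕ-injective a=b))
  ... | tri> _ _ b<a = subst (C m) (segment-comm b a) (segment∈C-ordered b a b<a)

  -- ∂ x t = x_{t-1} + x_t, with x_{-1} = x_m = 0.
  ∂ : Z2^ m → Vertex → Bool
  ∂ x t = lookup (differences false x) t

  ∂-⊕ : ∀ x y t → ∂ (x ⊕ y) t ≡ ∂ x t xor ∂ y t
  ∂-⊕ x y t = trans (cong (λ v → lookup v t) (differences-⊕ false false x y))
                    (lookup-⊕ (differences false x) (differences false y) t)

  ∂-𝟎 : ∀ t → ∂ 𝟎 t ≡ false
  ∂-𝟎 t = trans (cong (λ v → lookup v t) differences-𝟎) (lookup-replicate t false)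

  ∂-injective : ∀ x y → (∀ t → ∂ x t ≡ ∂ y t) → x ≡ y
  ∂-injective x y h = begin
    x                       ≡⟨ sym (prefixSums-differences false x) ⟩
    prefixSums false (∂ x)  ≡⟨ prefixSums-cong false h ⟩
    prefixSums false (∂ y)  ≡⟨ prefixSums-differences false y ⟩
    y                       ∎
    where open ≡-Reasoning

  ∂-even : ∀ x → parity (∂ x) ≡ false
  ∂-even x = parity-differences false x

  ∂-prefixSums : ∀ (f : Vertex → Bool) → parity f ≡ false → ∀ t → ∂ (prefixSums false f) t ≡ f t
  ∂-prefixSums f = differences-prefixSums false f

  δ : Vertex → Vertex → Bool
  δ t a = toℕ t ≡ᵇ toℕ a

  δ-refl : ∀ a → δ a a ≡ true
  δ-refl a = Equivalence.to T-≡ (≡⇒≡ᵇ (toℕ a) (toℕ a) refl)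

  δ≡true⇒≡ : ∀ {t a} → δ t a ≡ true → t ≡ a
  δ≡true⇒≡ {t} {a} e = toℕ-injective (≡ᵇ⇒≡ (toℕ t) (toℕ a) (Equivalence.from T-≡ e))

  δ-distinct : ∀ {t a} → t ≢ a → δ t a ≡ false
  δ-distinct {t} {a} t≢a with δ t a in e
  ... | true  = ⊥-elim (t≢a (δ≡true⇒≡ e))
  ... | false = refl

  ∂-threshold : ∀ b t → ∂ (threshold b) t ≡ δ t b xor δ t last
  ∂-threshold b t = trans (differences-step m (toℕ b) t (toℕ≤pred[n] b))
                          (cong (λ u → δ t b xor (toℕ t ≡ᵇ u)) (sym (toℕ-fromℕ m)))

  ∂-segment : ∀ a b t → ∂ (segment a b) t ≡ δ t a xor δ t b
  ∂-segment a b t = begin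
    ∂ (threshold a ⊕ threshold b) t                 ≡⟨ ∂-⊕ (threshold a) (threshold b) t ⟩
    ∂ (threshold a) t xor ∂ (threshold b) t         ≡⟨ cong₂ _xor_ (∂-threshold a t) (∂-threshold b t) ⟩
    (δ t a xor δ t last) xor (δ t b xor δ t last)   ≡⟨ xor-interchange (δ t a) _ _ _ ⟩
    (δ t a xor δ t b) xor (δ t last xor δ t last)   ≡⟨ cong ((δ t a xor δ t b) xor_) (xor-same (δ t last)) ⟩
    (δ t a xor δ t b) xor false                     ≡⟨ xor-identityʳ _ ⟩
    δ t a xor δ t b                                 ∎
    where open ≡-Reasoning

  threshold-last : threshold last ≡ 𝟎
  threshold-last = ∂-injective _ _ λ t →
    trans (∂-threshold last t) (trans (xor-same (δ t last)) (sym (∂-𝟎 t)))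

  segment-last : ∀ a → segment a last ≡ threshold a
  segment-last a = trans (cong (threshold a ⊕_) threshold-last) (⊕-identityʳ (threshold a))

  segment-self : ∀ a → segment a a ≡ 𝟎
  segment-self a = ⊕-self (threshold a)

  segment-trans : ∀ a b c → segment a b ⊕ segment b c ≡ segment a c
  segment-trans a b c = begin
    (qa ⊕ qb) ⊕ (qb ⊕ qc)   ≡⟨ ⊕-assoc qa qb (qb ⊕ qc) ⟩
    qa ⊕ (qb ⊕ (qb ⊕ qc))   ≡⟨ cong (qa ⊕_) (sym (⊕-assoc qb qb qc)) ⟩
    qa ⊕ ((qb ⊕ qb) ⊕ qc)   ≡⟨ cong (λ v → qa ⊕ (v ⊕ qc)) (⊕-self qb) ⟩
    qa ⊕ (𝟎 ⊕ qc)           ≡⟨ cong (qa ⊕_) (⊕-identityˡ qc) ⟩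
    qa ⊕ qc                 ∎
    where
    open ≡-Reasoning
    qa qb qc : Z2^ m
    qa = threshold a
    qb = threshold b
    qc = threshold c

  segment-endpoint : ∀ a b t → ∂ (segment a b) t ≡ true → t ≡ a ⊎ t ≡ b
  segment-endpoint a b t h with xor≡true (trans (sym (∂-segment a b t)) h)
  ... | inj₁ t=a = inj₁ (δ≡true⇒≡ t=a)
  ... | inj₂ t=b = inj₂ (δ≡true⇒≡ t=b)

  segment-∂-left : ∀ {a b} → a ≢ b → ∂ (segment a b) a ≡ true
  segment-∂-left {a} {b} a≢b = trans (∂-segment a b a) (cong₂ _xor_ (δ-refl a) (δ-distinct a≢b))

  segment-∂-right : ∀ {a b} → a ≢ b → ∂ (segment a b) b ≡ true
  segment-∂-right {a} {b} a≢b =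
    trans (cong (λ v → ∂ v b) (segment-comm a b)) (segment-∂-left (λ e → a≢b (sym e)))

  segment-nonzero : ∀ {a b} → a ≢ b → segment a b ≢ 𝟎
  segment-nonzero {a} a≢b e =
    true≢false (trans (sym (segment-∂-left a≢b)) (trans (cong (λ v → ∂ v a) e) (∂-𝟎 a)))

  threshold-injective : ∀ {a b} → threshold a ≡ threshold b → a ≡ b
  threshold-injective {a} {b} e with a ≟ b
  ... | yes a=b = a=b
  ... | no  a≢b = ⊥-elim (segment-nonzero a≢b (trans (cong (_⊕ threshold b) e) (⊕-self (threshold b))))

  threshold-nonzero : ∀ {a} → a ≢ last → threshold a ≢ 𝟎
  threshold-nonzero {a} a≢last e = segment-nonzero a≢last (trans (segment-last a) e)

  segment-injective : ∀ {a b c d} → a ≢ b → segment a b ≡ segment c d → (a ≡ c × b ≡ d) ⊎ (a ≡ d × b ≡ c)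
  segment-injective {a} {b} {c} {d} a≢b e = distinct-in-pair a≢b
    (segment-endpoint c d a (trans (cong (λ v → ∂ v a) (sym e)) (segment-∂-left a≢b)))
    (segment-endpoint c d b (trans (cong (λ v → ∂ v b) (sym e)) (segment-∂-right a≢b)))

  otherEndpoint : ∀ {x c} → IsSegment x → ∂ x c ≡ true → Σ Vertex λ u → x ≡ segment c u
  otherEndpoint {c = c} (a , b , _ , refl) h = choose (segment-endpoint a b c h)
    where
    choose : c ≡ a ⊎ c ≡ b → Σ Vertex λ u → segment a b ≡ segment c u
    choose (inj₁ refl) = b , refl
    choose (inj₂ refl) = a , segment-comm a b

  ∂-segment-sum : ∀ a b c d t → ∂ (segment a b ⊕ segment c d) t ≡ (δ t a xor δ t b) xor (δ t c xor δ t d)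
  ∂-segment-sum a b c d t = trans (∂-⊕ (segment a b) (segment c d) t) (cong₂ _xor_ (∂-segment a b t) (∂-segment c d t))

  -- If the sum of two edges ab and cd is again an edge, the two edges share an endpoint:
  -- otherwise a, b, c (and d) would all be endpoints of the sum.
  segments-meet : ∀ {a b c d} → a ≢ b → c ≢ d → IsSegment (segment a b ⊕ segment c d) →
                  (a ≡ c ⊎ a ≡ d) ⊎ (b ≡ c ⊎ b ≡ d)
  segments-meet {a} {b} {c} {d} a≢b c≢d (e , f , _ , sum≡ef) = decide (a ≟ c) (a ≟ d) (b ≟ c) (b ≟ d)
    where
    endpoint : ∀ t → (δ t a xor δ t b) xor (δ t c xor δ t d) ≡ true → t ≡ e ⊎ t ≡ f
    endpoint t h = segment-endpoint e f t
      (trans (cong (λ v → ∂ v t) (sym sum≡ef)) (trans (∂-segment-sum a b c d t) h))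
    decide : Dec (a ≡ c) → Dec (a ≡ d) → Dec (b ≡ c) → Dec (b ≡ d) → (a ≡ c ⊎ a ≡ d) ⊎ (b ≡ c ⊎ b ≡ d)
    decide (yes a=c) _         _         _         = inj₁ (inj₁ a=c)
    decide (no _)    (yes a=d) _         _         = inj₁ (inj₂ a=d)
    decide (no _)    (no _)    (yes b=c) _         = inj₂ (inj₁ b=c)
    decide (no _)    (no _)    (no _)    (yes b=d) = inj₂ (inj₂ b=d)
    decide (no a≢c)  (no a≢d)  (no b≢c)  (no b≢d)  = ⊥-elim (no-three-in-pair a≢b a≢c b≢c
      (endpoint a (only-first (δ-refl a) (δ-distinct a≢b) (δ-distinct a≢c) (δ-distinct a≢d)))
      (endpoint b (only-second (δ-distinct (λ p → a≢b (sym p))) (δ-refl b) (δ-distinct b≢c) (δ-distinct b≢d)))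
      (endpoint c (only-third (δ-distinct (λ p → a≢c (sym p))) (δ-distinct (λ p → b≢c (sym p)))
                              (δ-refl c) (δ-distinct c≢d))))

  segment-through : ∀ {u w x y} → u ≢ w → u ≡ x ⊎ u ≡ y → w ≡ x ⊎ w ≡ y → segment x y ≡ segment u w
  segment-through u≢w (inj₁ refl) (inj₂ refl) = refl
  segment-through {u} {w} u≢w (inj₂ refl) (inj₁ refl) = segment-comm w u
  segment-through u≢w (inj₁ refl) (inj₁ refl) = ⊥-elim (u≢w refl)
  segment-through u≢w (inj₂ refl) (inj₂ refl) = ⊥-elim (u≢w refl)

  common-endpoint : ∀ {x y} → IsSegment x → IsSegment y → IsSegment (x ⊕ y) →
                    Σ Vertex λ c → ∂ x c ≡ true × ∂ y c ≡ true
  common-endpoint (a , b , a≢b , refl) (a′ , b′ , a′≢b′ , refl) sum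
    with segments-meet a≢b a′≢b′ sum
  ... | inj₁ (inj₁ refl) = a , segment-∂-left a≢b  , segment-∂-left a′≢b′
  ... | inj₁ (inj₂ refl) = a , segment-∂-left a≢b  , segment-∂-right a′≢b′
  ... | inj₂ (inj₁ refl) = b , segment-∂-right a≢b , segment-∂-left a′≢b′
  ... | inj₂ (inj₂ refl) = b , segment-∂-right a≢b , segment-∂-right a′≢b′

  act : Permutation′ (suc m) → Z2^ m → Z2^ m
  act ρ x = prefixSums false (λ t → ∂ x (ρ ⟨$⟩ˡ t))

  -- The defining property of act; ∂ x ∘ ρ⁻¹ is even because ∂ x is.
  ∂-act : ∀ ρ x t → ∂ (act ρ x) t ≡ ∂ x (ρ ⟨$⟩ˡ t)
  ∂-act ρ x = ∂-prefixSums _ (trans (sym (parity-permute (∂ x) (flip ρ))) (∂-even x))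

  act-⊕ : ∀ ρ → IsLinear (act ρ)
  act-⊕ ρ x y = ∂-injective _ _ λ t → begin
    ∂ (act ρ (x ⊕ y)) t                          ≡⟨ ∂-act ρ (x ⊕ y) t ⟩
    ∂ (x ⊕ y) (ρ ⟨$⟩ˡ t)                         ≡⟨ ∂-⊕ x y (ρ ⟨$⟩ˡ t) ⟩
    ∂ x (ρ ⟨$⟩ˡ t) xor ∂ y (ρ ⟨$⟩ˡ t)            ≡⟨ sym (cong₂ _xor_ (∂-act ρ x t) (∂-act ρ y t)) ⟩
    ∂ (act ρ x) t xor ∂ (act ρ y) t              ≡⟨ sym (∂-⊕ (act ρ x) (act ρ y) t) ⟩
    ∂ (act ρ x ⊕ act ρ y) t                      ∎
    where open ≡-Reasoning

  δ≡true⇔ : ∀ {t a} → (δ t a ≡ true) ⇔ (t ≡ a)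
  δ≡true⇔ {t} = mk⇔ δ≡true⇒≡ (λ { refl → δ-refl t })

  δ-permute : ∀ ρ t a → δ (ρ ⟨$⟩ˡ t) a ≡ δ t (ρ ⟨$⟩ʳ a)
  δ-permute ρ t a = ⇔→≡ (mk⇔
    (λ e → Equivalence.from δ≡true⇔ (trans (sym (inverseʳ ρ)) (cong (ρ ⟨$⟩ʳ_) (Equivalence.to δ≡true⇔ e))))
    (λ e → Equivalence.from δ≡true⇔ (trans (cong (ρ ⟨$⟩ˡ_) (Equivalence.to δ≡true⇔ e)) (inverseˡ ρ))))

  act-segment : ∀ ρ a b → act ρ (segment a b) ≡ segment (ρ ⟨$⟩ʳ a) (ρ ⟨$⟩ʳ b)
  act-segment ρ a b = ∂-injective _ _ λ t → begin
    ∂ (act ρ (segment a b)) t                     ≡⟨ ∂-act ρ (segment a b) t ⟩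
    ∂ (segment a b) (ρ ⟨$⟩ˡ t)                    ≡⟨ ∂-segment a b (ρ ⟨$⟩ˡ t) ⟩
    δ (ρ ⟨$⟩ˡ t) a xor δ (ρ ⟨$⟩ˡ t) b             ≡⟨ cong₂ _xor_ (δ-permute ρ t a) (δ-permute ρ t b) ⟩
    δ t (ρ ⟨$⟩ʳ a) xor δ t (ρ ⟨$⟩ʳ b)             ≡⟨ sym (∂-segment (ρ ⟨$⟩ʳ a) (ρ ⟨$⟩ʳ b) t) ⟩
    ∂ (segment (ρ ⟨$⟩ʳ a) (ρ ⟨$⟩ʳ b)) t           ∎
    where open ≡-Reasoning

  act-inverse : ∀ ρ x → act (flip ρ) (act ρ x) ≡ x
  act-inverse ρ x = ∂-injective _ _ λ t →
    trans (∂-act (flip ρ) (act ρ x) t) (trans (∂-act ρ x (ρ ⟨$⟩ʳ t)) (cong (∂ x) (inverseˡ ρ)))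

  act-bijective : ∀ ρ → Bijective _≡_ _≡_ (act ρ)
  act-bijective ρ =
    (λ {x} {y} e → trans (sym (act-inverse ρ x)) (trans (cong (act (flip ρ)) e) (act-inverse ρ y))) ,
    λ y → act (flip ρ) y , λ { refl → act-inverse (flip ρ) y }

  act-C : ∀ ρ x → C m x → C m (act ρ x)
  act-C ρ x cx with C⇒IsSegment x cx
  ... | a , b , a≢b , refl = subst (C m) (sym (act-segment ρ a b))
                                   (segment∈C (λ e → a≢b (permutation-injective ρ e)))

  act-bijOnto-C : ∀ ρ → BijOnto (act ρ) (C m) (C m)
  act-bijOnto-C ρ = bijOnto-viaInverse (act ρ) (act (flip ρ)) (act-inverse ρ) (act-inverse (flip ρ))
                                       (act-C ρ) (act-C (flip ρ))

-- A linear injection T of ℤ₂^m mapping C(m) into itself is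
-- induced by a vertex permutation ρ: T (segment a b) = segment (ρ a) (ρ b).
-- The images of the star edges 'threshold i = segment i last' are edges that pairwise
-- meet; being unable to form a triangle (T is injective), they all pass through one
-- vertex c, the centre, and ρ i is the other endpoint of the image of the star edge i.

module Whitney (m : ℕ) (T : Z2^ m → Z2^ m) (T-⊕ : IsLinear T)
               (T-injective : ∀ {x y} → T x ≡ T y → x ≡ y) (T-C : ∀ x → C m x → C m (T x)) where

  open Segments m

  T-segment : ∀ {a b} → a ≢ b → IsSegment (T (segment a b))
  T-segment a≢b = C⇒IsSegment _ (T-C _ (segment∈C a≢b))

  star : Vertex → Z2^ m
  star i = T (threshold i)

  star-edge : ∀ {i} → i ≢ last → IsSegment (star i)
  star-edge {i} i≢last = subst (λ v → IsSegment (T v)) (segment-last i) (T-segment i≢last)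

  stars-sum : ∀ {i j} → i ≢ j → IsSegment (star i ⊕ star j)
  stars-sum {i} {j} i≢j = subst IsSegment (T-⊕ (threshold i) (threshold j)) (T-segment i≢j)

  Centre : Vertex → Set
  Centre c = ∀ i → i ≢ last → ∂ (star i) c ≡ true

  module FromCentre {c : Vertex} (centre : Centre c) where

    -- The other endpoint of the star image at i (with the degenerate star at the last vertex sent to c).
    partner : ∀ i → Σ Vertex λ u → star i ≡ segment c u
    partner i = by-cases (i ≟ last)
      where
      by-cases : Dec (i ≡ last) → Σ Vertex λ u → star i ≡ segment c u
      by-cases (yes refl)   = c , trans (cong T threshold-last) (trans (linear-𝟎 T T-⊕) (sym (segment-self c)))
      by-cases (no i≢last) = otherEndpoint (star-edge i≢last) (centre i i≢last)

    κ : Vertex → Vertex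
    κ i = proj₁ (partner i)

    star≡ : ∀ i → star i ≡ segment c (κ i)
    star≡ i = proj₂ (partner i)

    T-segment-κ : ∀ a b → T (segment a b) ≡ segment (κ a) (κ b)
    T-segment-κ a b = begin
      T (threshold a ⊕ threshold b)         ≡⟨ T-⊕ (threshold a) (threshold b) ⟩
      star a ⊕ star b                       ≡⟨ cong₂ _⊕_ (trans (star≡ a) (segment-comm c (κ a))) (star≡ b) ⟩
      segment (κ a) c ⊕ segment c (κ b)     ≡⟨ segment-trans (κ a) c (κ b) ⟩
      segment (κ a) (κ b)                   ∎
      where open ≡-Reasoning

    κ-injective : ∀ {a b} → κ a ≡ κ b → a ≡ b
    κ-injective {a} {b} e =
      threshold-injective (T-injective (trans (star≡ a) (trans (cong (segment c) e) (sym (star≡ b)))))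

  module CommonEndpoint {v₀ v₁ c : Vertex} (v₀≢last : v₀ ≢ last) (v₁≢last : v₁ ≢ last) (v₀≢v₁ : v₀ ≢ v₁)
                        (c∈₀ : ∂ (star v₀) c ≡ true) (c∈₁ : ∂ (star v₁) c ≡ true) where

    u w : Vertex
    u = proj₁ (otherEndpoint (star-edge v₀≢last) c∈₀)
    w = proj₁ (otherEndpoint (star-edge v₁≢last) c∈₁)

    star₀≡ : star v₀ ≡ segment c u
    star₀≡ = proj₂ (otherEndpoint (star-edge v₀≢last) c∈₀)

    star₁≡ : star v₁ ≡ segment c w
    star₁≡ = proj₂ (otherEndpoint (star-edge v₁≢last) c∈₁)

    c≢partner : ∀ {v z} → v ≢ last → star v ≡ segment c z → c ≢ z
    c≢partner v≢last star≡ refl =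
      threshold-nonzero v≢last (T-injective (trans star≡ (trans (segment-self c) (sym (linear-𝟎 T T-⊕)))))

    u≢w : u ≢ w
    u≢w e = v₀≢v₁ (threshold-injective (T-injective (trans star₀≡ (trans (cong (segment c) e) (sym star₁≡)))))

    -- A third star image xy avoiding c meets cu and cw, so it is the edge uw; the triangle
    -- cu, cw, uw sums to zero, and pulling back along T gives
    -- segment v₀ v₁ = threshold i = segment i last, impossible for i ∉ {v₀, v₁, last}.
    triangle-impossible : ∀ {i x y} → i ≢ last → i ≢ v₀ → i ≢ v₁ → x ≢ y → star i ≡ segment x y →
                          ∂ (star i) c ≡ false → ⊥
    triangle-impossible {i} {x} {y} i≢last i≢v₀ i≢v₁ x≢y starᵢ≡ c∉ =
      excluded (segment-injective v₀≢v₁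
        (trans (⊕≡𝟎⇒≡ (T-injective (trans triangle-sum (sym (linear-𝟎 T T-⊕))))) (sym (segment-last i))))
      where
      c≢endpoint : ∀ {z} → ∂ (segment x y) z ≡ true → c ≢ z
      c≢endpoint z∈ refl = true≢false (trans (sym z∈) (trans (cong (λ v → ∂ v c) (sym starᵢ≡)) c∉))
      avoid-c : ∀ {t} → (c ≡ x ⊎ c ≡ y) ⊎ (t ≡ x ⊎ t ≡ y) → t ≡ x ⊎ t ≡ y
      avoid-c (inj₁ (inj₁ c=x)) = ⊥-elim (c≢endpoint (segment-∂-left x≢y) c=x)
      avoid-c (inj₁ (inj₂ c=y)) = ⊥-elim (c≢endpoint (segment-∂-right x≢y) c=y)
      avoid-c (inj₂ t∈xy)       = t∈xy
      u∈xy : u ≡ x ⊎ u ≡ y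
      u∈xy = avoid-c (segments-meet (c≢partner v₀≢last star₀≡) x≢y
                        (subst₂ (λ p q → IsSegment (p ⊕ q)) star₀≡ starᵢ≡ (stars-sum (λ e → i≢v₀ (sym e)))))
      w∈xy : w ≡ x ⊎ w ≡ y
      w∈xy = avoid-c (segments-meet (c≢partner v₁≢last star₁≡) x≢y
                        (subst₂ (λ p q → IsSegment (p ⊕ q)) star₁≡ starᵢ≡ (stars-sum (λ e → i≢v₁ (sym e)))))
      triangle-sum : T ((threshold v₀ ⊕ threshold v₁) ⊕ threshold i) ≡ 𝟎
      triangle-sum = begin
        T ((threshold v₀ ⊕ threshold v₁) ⊕ threshold i)   ≡⟨ T-⊕ (threshold v₀ ⊕ threshold v₁) (threshold i) ⟩
        T (threshold v₀ ⊕ threshold v₁) ⊕ star i           ≡⟨ cong (_⊕ star i) (T-⊕ (threshold v₀) (threshold v₁)) ⟩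
        (star v₀ ⊕ star v₁) ⊕ star i                       ≡⟨ cong₂ _⊕_ (cong₂ _⊕_ (trans star₀≡ (segment-comm c u)) star₁≡)
                                                                         (trans starᵢ≡ (segment-through u≢w u∈xy w∈xy)) ⟩
        (segment u c ⊕ segment c w) ⊕ segment u w          ≡⟨ cong (_⊕ segment u w) (segment-trans u c w) ⟩
        segment u w ⊕ segment u w                          ≡⟨ ⊕-self (segment u w) ⟩
        𝟎                                                  ∎
        where open ≡-Reasoning
      excluded : (v₀ ≡ i × v₁ ≡ last) ⊎ (v₀ ≡ last × v₁ ≡ i) → ⊥
      excluded (inj₁ (v₀=i , _))    = i≢v₀ (sym v₀=i)
      excluded (inj₂ (v₀=last , _)) = v₀≢last v₀=last

    no-star-avoids-c : ∀ {i} → i ≢ last → ∂ (star i) c ≡ false → ⊥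
    no-star-avoids-c {i} i≢last c∉ = by-cases (i ≟ v₀) (i ≟ v₁)
      where
      by-cases : Dec (i ≡ v₀) → Dec (i ≡ v₁) → ⊥
      by-cases (yes refl) _          = true≢false (trans (sym c∈₀) c∉)
      by-cases (no _)     (yes refl) = true≢false (trans (sym c∈₁) c∉)
      by-cases (no i≢v₀)  (no i≢v₁)  =
        triangle-impossible i≢last i≢v₀ i≢v₁ (proj₁ (proj₂ (proj₂ edgeᵢ))) (proj₂ (proj₂ (proj₂ edgeᵢ))) c∉
        where
        edgeᵢ : IsSegment (star i)
        edgeᵢ = star-edge i≢last

    centre : Centre c
    centre i i≢last = ¬-not (no-star-avoids-c i≢last)

  centre-exists : Σ Vertex Centre
  centre-exists = first-star (any? (λ v → ¬? (v ≟ last)))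
    where
    from-two : ∀ {v₀ v₁} → v₀ ≢ last → v₁ ≢ last → v₀ ≢ v₁ → Σ Vertex Centre
    from-two {v₀} {v₁} v₀≢last v₁≢last v₀≢v₁ =
      c , CommonEndpoint.centre v₀≢last v₁≢last v₀≢v₁ (proj₁ (proj₂ meeting)) (proj₂ (proj₂ meeting))
      where
      meeting : Σ Vertex λ c → ∂ (star v₀) c ≡ true × ∂ (star v₁) c ≡ true
      meeting = common-endpoint (star-edge v₀≢last) (star-edge v₁≢last) (stars-sum v₀≢v₁)
      c : Vertex
      c = proj₁ meeting
    from-one : ∀ {v₀} → v₀ ≢ last → (∀ i → i ≢ last → i ≡ v₀) → Σ Vertex Centre
    from-one {v₀} v₀≢last only =
      a , λ i i≢last → subst (λ j → ∂ (star j) a ≡ true) (sym (only i i≢last))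
                             (trans (cong (λ v → ∂ v a) star≡) (segment-∂-left a≢b))
      where
      edge₀ : IsSegment (star v₀)
      edge₀ = star-edge v₀≢last
      a b : Vertex
      a = proj₁ edge₀
      b = proj₁ (proj₂ edge₀)
      a≢b : a ≢ b
      a≢b = proj₁ (proj₂ (proj₂ edge₀))
      star≡ : star v₀ ≡ segment a b
      star≡ = proj₂ (proj₂ (proj₂ edge₀))
    second-star : ∀ {v₀} → v₀ ≢ last → Dec (Σ Vertex λ v → v ≢ last × v ≢ v₀) → Σ Vertex Centre
    second-star v₀≢last (yes (v₁ , v₁≢last , v₁≢v₀)) = from-two v₀≢last v₁≢last (λ e → v₁≢v₀ (sym e))
    second-star {v₀} v₀≢last (no none) = from-one v₀≢last only
      where
      only : ∀ i → i ≢ last → i ≡ v₀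
      only i i≢last with i ≟ v₀
      ... | yes i=v₀ = i=v₀
      ... | no  i≢v₀ = ⊥-elim (none (i , i≢last , i≢v₀))
    first-star : Dec (Σ Vertex λ v → v ≢ last) → Σ Vertex Centre
    first-star (no none)             = last , λ i i≢last → ⊥-elim (none (i , i≢last))
    first-star (yes (v₀ , v₀≢last)) = second-star v₀≢last (any? (λ v → ¬? (v ≟ last) ×-dec ¬? (v ≟ v₀)))

  induced-permutation : Σ (Permutation′ (suc m)) λ ρ → ∀ a b → T (segment a b) ≡ segment (ρ ⟨$⟩ʳ a) (ρ ⟨$⟩ʳ b)
  induced-permutation = ρ , λ a b → trans (T-segment-κ a b) (sym (cong₂ segment (ρ≗κ a) (ρ≗κ b)))
    where
    open FromCentre (proj₂ centre-exists)
    κ-permutation : Σ (Permutation′ (suc m)) λ ρ → ∀ i → ρ ⟨$⟩ʳ i ≡ κ i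
    κ-permutation = injective⇒permutation κ κ-injective
    ρ : Permutation′ (suc m)
    ρ = proj₁ κ-permutation
    ρ≗κ : ∀ i → ρ ⟨$⟩ʳ i ≡ κ i
    ρ≗κ = proj₂ κ-permutation

module Codings (m : ℕ) where

  open Segments m

  -- The reversed labeling u ↦ m - σ u, under which codes become segments.
  reversed : Permutation′ (suc m) → Permutation′ (suc m)
  reversed σ = σ ∘ₚ reverse

  code-segment : ∀ σ u v → fedge (suc m) (σ ⟨$⟩ʳ u) (σ ⟨$⟩ʳ v) ≡ segment (reversed σ ⟨$⟩ʳ u) (reversed σ ⟨$⟩ʳ v)
  code-segment σ u v = fedge-segment (σ ⟨$⟩ʳ u) (σ ⟨$⟩ʳ v)

  adjacent⇒distinct : ∀ (G : SimpleGraph (suc m)) {u v} → adj G u v ≡ true → u ≢ v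
  adjacent⇒distinct G {u} uv refl = true≢false (trans (sym uv) (irrefl G u))

  adjacent-pair : ∀ (G : SimpleGraph (suc m)) {u v u′ v′} → (u ≡ u′ × v ≡ v′) ⊎ (u ≡ v′ × v ≡ u′) →
                  adj G u′ v′ ≡ true → adj G u v ≡ true
  adjacent-pair G (inj₁ (refl , refl)) uv = uv
  adjacent-pair G {u} {v} (inj₂ (refl , refl)) vu = trans (SimpleGraph.sym G u v) vu

  segment-injective-along : ∀ (f : Vertex → Vertex) → (∀ {a b} → f a ≡ f b → a ≡ b) →
                            ∀ {u v u′ v′} → u ≢ v → segment (f u) (f v) ≡ segment (f u′) (f v′) →
                            (u ≡ u′ × v ≡ v′) ⊎ (u ≡ v′ × v ≡ u′)
  segment-injective-along f f-inj {u} {v} {u′} {v′} u≢v e = pull (segment-injective (λ p → u≢v (f-inj p)) e)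
    where
    pull : (f u ≡ f u′ × f v ≡ f v′) ⊎ (f u ≡ f v′ × f v ≡ f u′) → (u ≡ u′ × v ≡ v′) ⊎ (u ≡ v′ × v ≡ u′)
    pull (inj₁ (p , q)) = inj₁ (f-inj p , f-inj q)
    pull (inj₂ (p , q)) = inj₂ (f-inj p , f-inj q)

  module Transfer (G H : SimpleGraph (suc m)) (σ τ : Permutation′ (suc m)) (T : Z2^ m → Z2^ m)
                  (κ : Vertex → Vertex) (T-κ : ∀ a b → T (segment a b) ≡ segment (κ a) (κ b))
                  (π : Permutation′ (suc m))
                  (κ-π : ∀ u → κ (reversed σ ⟨$⟩ʳ u) ≡ reversed τ ⟨$⟩ʳ (π ⟨$⟩ʳ u)) where

    τπ : Vertex → Vertex
    τπ u = reversed τ ⟨$⟩ʳ (π ⟨$⟩ʳ u)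

    τπ-injective : ∀ {a b} → τπ a ≡ τπ b → a ≡ b
    τπ-injective e = permutation-injective π (permutation-injective (reversed τ) e)

    T-code : ∀ u v → T (fedge (suc m) (σ ⟨$⟩ʳ u) (σ ⟨$⟩ʳ v)) ≡ fedge (suc m) (τ ⟨$⟩ʳ (π ⟨$⟩ʳ u)) (τ ⟨$⟩ʳ (π ⟨$⟩ʳ v))
    T-code u v = begin
      T (fedge (suc m) (σ ⟨$⟩ʳ u) (σ ⟨$⟩ʳ v))          ≡⟨ cong T (code-segment σ u v) ⟩
      T (segment (reversed σ ⟨$⟩ʳ u) (reversed σ ⟨$⟩ʳ v)) ≡⟨ T-κ (reversed σ ⟨$⟩ʳ u) (reversed σ ⟨$⟩ʳ v) ⟩
      segment (κ (reversed σ ⟨$⟩ʳ u)) (κ (reversed σ ⟨$⟩ʳ v)) ≡⟨ cong₂ segment (κ-π u) (κ-π v) ⟩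
      segment (τπ u) (τπ v)                             ≡⟨ sym (code-segment τ (π ⟨$⟩ʳ u) (π ⟨$⟩ʳ v)) ⟩
      fedge (suc m) (τ ⟨$⟩ʳ (π ⟨$⟩ʳ u)) (τ ⟨$⟩ʳ (π ⟨$⟩ʳ v)) ∎
      where open ≡-Reasoning

    coding-forward : (∀ u v → adj G u v ≡ true → adj H (π ⟨$⟩ʳ u) (π ⟨$⟩ʳ v) ≡ true) →
                     ∀ x → coding G σ x → coding H τ (T x)
    coding-forward π-adj x (u , v , uv , refl) = π ⟨$⟩ʳ u , π ⟨$⟩ʳ v , π-adj u v uv , T-code u v

    adjacency-forward : (∀ x → coding G σ x → coding H τ (T x)) →
                        ∀ u v → adj G u v ≡ true → adj H (π ⟨$⟩ʳ u) (π ⟨$⟩ʳ v) ≡ true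
    adjacency-forward into u v uv = conclude (into _ (u , v , uv , refl))
      where
      conclude : coding H τ (T (fedge (suc m) (σ ⟨$⟩ʳ u) (σ ⟨$⟩ʳ v))) → adj H (π ⟨$⟩ʳ u) (π ⟨$⟩ʳ v) ≡ true
      conclude (u′ , v′ , u′v′ , Tx≡) = adjacent-pair H
        (segment-injective-along (reversed τ ⟨$⟩ʳ_) (permutation-injective (reversed τ))
          (λ e → adjacent⇒distinct G uv (permutation-injective π e))
          (trans (sym (code-segment τ (π ⟨$⟩ʳ u) (π ⟨$⟩ʳ v)))
                 (trans (sym (T-code u v)) (trans Tx≡ (code-segment τ u′ v′)))))
        u′v′

    adjacency-backward : (∀ y → coding H τ y → ∃ λ x → coding G σ x × T x ≡ y) →
                         ∀ u v → adj H (π ⟨$⟩ʳ u) (π ⟨$⟩ʳ v) ≡ true → adj G u v ≡ true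
    adjacency-backward onto u v πuv = conclude (onto _ (π ⟨$⟩ʳ u , π ⟨$⟩ʳ v , πuv , refl))
      where
      y : Z2^ m
      y = fedge (suc m) (τ ⟨$⟩ʳ (π ⟨$⟩ʳ u)) (τ ⟨$⟩ʳ (π ⟨$⟩ʳ v))
      conclude : (∃ λ x → coding G σ x × T x ≡ y) → adj G u v ≡ true
      conclude (_ , (u₁ , v₁ , u₁v₁ , refl) , Tx≡) = adjacent-pair G
        (segment-injective-along τπ τπ-injective (λ e → adjacent⇒distinct H πuv (cong (π ⟨$⟩ʳ_) e))
          (trans (sym (code-segment τ (π ⟨$⟩ʳ u) (π ⟨$⟩ʳ v)))
                 (trans (sym Tx≡) (trans (T-code u₁ v₁) (code-segment τ (π ⟨$⟩ʳ u₁) (π ⟨$⟩ʳ v₁))))))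
        u₁v₁

  isomorphism⇒strongIso : ∀ {G H : SimpleGraph (suc m)} {σ τ : Permutation′ (suc m)} → 2 ≤ suc m →
                          G ≅G H → StronglyIso (suc m) (coding G σ) (coding H τ)
  isomorphism⇒strongIso {G} {H} {σ} {τ} 2≤n (π , π-adj) =
    2≤n , act ρ , act-⊕ ρ , act-bijective ρ , act-bijOnto-C ρ ,
    bijOnto-viaInverse (act ρ) (act (flip ρ)) (act-inverse ρ) (act-inverse (flip ρ))
      (Transfer.coding-forward G H σ τ (act ρ) (ρ ⟨$⟩ʳ_) (act-segment ρ) π ρ-π
         (λ u v uv → trans (sym (π-adj u v)) uv))
      (Transfer.coding-forward H G τ σ (act (flip ρ)) (flip ρ ⟨$⟩ʳ_) (act-segment (flip ρ)) (flip π) ρ⁻¹-π⁻¹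
         (λ u v uv → trans (π-adj (π ⟨$⟩ˡ u) (π ⟨$⟩ˡ v)) (trans (cong₂ (adj H) (inverseʳ π) (inverseʳ π)) uv)))
    where
    ρ : Permutation′ (suc m)
    ρ = flip (reversed σ) ∘ₚ π ∘ₚ reversed τ
    ρ-π : ∀ u → ρ ⟨$⟩ʳ (reversed σ ⟨$⟩ʳ u) ≡ reversed τ ⟨$⟩ʳ (π ⟨$⟩ʳ u)
    ρ-π u = cong (λ w → reversed τ ⟨$⟩ʳ (π ⟨$⟩ʳ w)) (inverseˡ (reversed σ))
    ρ⁻¹-π⁻¹ : ∀ u → flip ρ ⟨$⟩ʳ (reversed τ ⟨$⟩ʳ u) ≡ reversed σ ⟨$⟩ʳ (flip π ⟨$⟩ʳ u)
    ρ⁻¹-π⁻¹ u = cong (λ w → reversed σ ⟨$⟩ʳ (π ⟨$⟩ˡ w)) (inverseˡ (reversed τ))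

  strongIso⇒isomorphism : ∀ {G H : SimpleGraph (suc m)} {σ τ : Permutation′ (suc m)} →
                          StronglyIso (suc m) (coding G σ) (coding H τ) → G ≅G H
  strongIso⇒isomorphism {G} {H} {σ} {τ} (_ , T , T-⊕ , (T-injective , _) , (T-C , _) , (into , _ , onto)) =
    π , λ u v → ⇔→≡ (mk⇔ (adjacency-forward into u v) (adjacency-backward onto u v))
    where
    induced : Σ (Permutation′ (suc m)) λ ρ → ∀ a b → T (segment a b) ≡ segment (ρ ⟨$⟩ʳ a) (ρ ⟨$⟩ʳ b)
    induced = Whitney.induced-permutation m T T-⊕ T-injective T-C
    ρ : Permutation′ (suc m)
    ρ = proj₁ induced
    π : Permutation′ (suc m)
    π = reversed σ ∘ₚ ρ ∘ₚ flip (reversed τ)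
    open Transfer G H σ τ T (ρ ⟨$⟩ʳ_) (proj₂ induced) π (λ u → sym (inverseʳ (reversed τ)))

theorem4 : (n : ℕ) → 2 ≤ n → (G H : SimpleGraph n) → (σ τ : Permutation′ n) →
    (G ≅G H) ⇔ StronglyIso n (coding G σ) (coding H τ)
theorem4 zero    ()
theorem4 (suc m) 2≤n G H σ τ = mk⇔ (isomorphism⇒strongIso {G} {H} {σ} {τ} 2≤n) (strongIso⇒isomorphism {G} {H} {σ} {τ})
  where open Codings m
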